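{- Let $M$ and $D$ be $n\times n$ matrices with entries in $\mathbb{Z}_2$ such that $M$ is non-degenerate and $D$ is diagonal. Then $\operatorname{rk}(M+D)\ge \operatorname{rk}(M+I)/2$, where $I$ is the $n\times n$ identity matrix.
   Context: A matrix is diagonal if all its entries outside the main diagonal are $0$. Ranks are over $\mathbb{Z}_2$. -}

module Defs where

open import Data.Bool using (Bool; true; false; _xor_; _∧_; if_then_else_)
open import Data.Nat using (ℕ; zero; suc; _<_)
open import Data.Fin using (Fin; zero; suc; _≟_)
open import Relation.Nullary using (does)
open import Relation.Binary.PropositionalEquality using (_≡_)
open import Data.Product using (∃; _×_)
open import Data.Empty using (⊥)

-- The field ℤ₂ is modelled by Bool: addition is xor, multiplication is ∧.
Z₂ : Set
Z₂ = Bool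

-- n × n matrices over ℤ₂, entry (i , j) = row i, column j.
Mat : ℕ → Set
Mat n = Fin n → Fin n → Z₂

Vec₂ : ℕ → Set
Vec₂ n = Fin n → Z₂

Σ₂ : ∀ {k} → (Fin k → Z₂) → Z₂
Σ₂ {zero} f = false
Σ₂ {suc k} f = f zero xor Σ₂ (λ i → f (suc i))

_+ᴹ_ : ∀ {n} → Mat n → Mat n → Mat n
(A +ᴹ B) i j = A i j xor B i j

identity : ∀ {n} → Mat n
identity i j = does (i ≟ j)

IsDiagonal : ∀ {n} → Mat n → Set
IsDiagonal {n} D = ∀ (i j : Fin n) → (i ≡ j → ⊥) → D i j ≡ false

LinIndep : ∀ {n k} → (Fin k → Vec₂ n) → Set
LinIndep {n} {k} v =
  ∀ (c : Fin k → Z₂) →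
  (∀ (j : Fin n) → Σ₂ (λ i → c i ∧ v i j) ≡ false) →
  ∀ (i : Fin k) → c i ≡ false

col : ∀ {n} → Mat n → Fin n → Vec₂ n
col A j i = A i j

IsRank : ∀ {n} → Mat n → ℕ → Set
IsRank {n} A r =
  ∃ (λ (f : Fin r → Fin n) → LinIndep (λ i → col A (f i)))
  × (∀ (k : ℕ) → r < k → (f : Fin k → Fin n) →
       LinIndep (λ i → col A (f i)) → ⊥)

NonDegenerate : ∀ {n} → Mat n → Set
NonDegenerate {n} M =
  ∀ (x : Vec₂ n) → (∀ (i : Fin n) → Σ₂ (λ j → M i j ∧ x j) ≡ false) →
  ∀ (j : Fin n) → x j ≡ false

-- Put A = M + D. Over ℤ₂, M = A + D and M + I = A + (D + I), where D and D + I are diagonal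
-- with complementary supports. The columns of a diagonal matrix lie in the span of the unit
-- vectors on its support, so n = rk M ≤ rk A + |supp D| and rk (M + I) ≤ rk A + |supp (D + I)|;
-- adding the two bounds gives rk (M + I) + n ≤ 2 rk A + n. Both bounds are instances of the
-- exchange lemma, which rests on the fact that more than m vectors of ℤ₂ᵐ are linearly
-- dependent (Gaussian elimination on the first coordinate).

module Submission where

open import Defs
open import Data.Nat using (ℕ; _≤_; _*_)
open import Algebra.Bundles using (CommutativeRing)
open import Data.Bool using (true; false; _xor_; _∧_)
open import Data.Bool.Properties as Bool
  using ( xor-∧-commutativeRing; xor-assoc; xor-comm; xor-same; xor-identityʳ
        ; ∧-assoc; ∧-comm; ∧-zeroʳ; ∧-identityʳ; ∧-distribˡ-xor; ¬-not )
open import Data.Empty using (⊥; ⊥-elim)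
open import Data.Fin using (Fin; zero; suc; punchIn; splitAt; _≟_)
open import Data.Fin.Properties using (any?; punchInᵢ≢i)
open import Data.List using ([]; _∷_; length; filter; allFin; lookup)
open import Data.List.Properties using (length-tabulate)
open import Data.List.Membership.Propositional.Properties using (∈-filter⁺; ∈-allFin)
open import Data.List.Relation.Unary.Any using (index)
open import Data.List.Relation.Unary.Any.Properties using (lookup-index)
open import Data.Nat using (zero; suc; _+_; _<_; s≤s)
open import Data.Nat.Properties using (+-suc; +-mono-≤; +-cancelʳ-≤; m≤n⇒m≤1+n; ≤-refl; _≤?_; ≰⇒>)
open import Data.Nat.Tactic.RingSolver using (solve-∀)
open import Data.Product using (∃; _×_; _,_; proj₁; proj₂)
open import Data.Sum using (_⊎_; inj₁; inj₂; [_,_]′)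
open import Data.Vec.Functional as Vector using (_++_; insertAt; removeAt; tail)
open import Data.Vec.Functional.Properties using (insertAt-lookup; insertAt-punchIn)
open import Function using (_∘_)
open import Level using (0ℓ)
open import Relation.Nullary using (¬_; yes; no)
open import Relation.Nullary.Decidable using (dec-true; dec-false)
open import Relation.Unary using (Pred; Decidable)
open import Relation.Unary.Properties using (∁?)
open import Relation.Binary.PropositionalEquality
  using (_≡_; _≗_; refl; sym; trans; cong; cong₂; subst; module ≡-Reasoning)

open import Algebra.Properties.Semiring.Sum (CommutativeRing.semiring xor-∧-commutativeRing)
  using (sum; sum-cong-≗; sum-replicate-zero; sum-remove; ∑-distrib-+; ∑-comm; *-distribˡ-sum; *-distribʳ-sum)

open ≡-Reasoning

xor≡false⇒≡ : ∀ x y → x xor y ≡ false → x ≡ y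
xor≡false⇒≡ false false _ = refl
xor≡false⇒≡ true  true  _ = refl

xor-cancelʳ : ∀ x y → x ≡ (x xor y) xor y
xor-cancelʳ x y = sym (begin
  (x xor y) xor y   ≡⟨ xor-assoc x y y ⟩
  x xor (y xor y)   ≡⟨ cong (x xor_) (xor-same y) ⟩
  x xor false       ≡⟨ xor-identityʳ x ⟩
  x                 ∎)

xor-through : ∀ x y z → x xor z ≡ (x xor y) xor (y xor z)
xor-through x y z = begin
  x xor z                  ≡⟨ cong (_xor z) (xor-cancelʳ x y) ⟩
  ((x xor y) xor y) xor z  ≡⟨ xor-assoc (x xor y) y z ⟩
  (x xor y) xor (y xor z)  ∎

Σ₂≡sum : ∀ {k} (f : Fin k → Z₂) → Σ₂ f ≡ sum f
Σ₂≡sum {zero}  f = refl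
Σ₂≡sum {suc k} f = cong (f zero xor_) (Σ₂≡sum (tail f))

Σ₂-cong : ∀ {k} {f g : Fin k → Z₂} → f ≗ g → Σ₂ f ≡ Σ₂ g
Σ₂-cong {f = f} {g} f≗g = trans (Σ₂≡sum f) (trans (sum-cong-≗ f≗g) (sym (Σ₂≡sum g)))

sum-zero : ∀ {k} {f : Fin k → Z₂} → (∀ i → f i ≡ false) → sum f ≡ false
sum-zero {k} f≡0 = trans (sum-cong-≗ f≡0) (sum-replicate-zero k)

++-tail : ∀ {A : Set} {a b} (f : Fin (suc a) → A) (g : Fin b → A) →
          (f ++ g) ∘ suc ≗ tail f ++ g
++-tail {a = a} f g i with splitAt a i
... | inj₁ _ = refl
... | inj₂ _ = refl

zipWith-++ : ∀ {A B C : Set} {a b} (_∙_ : A → B → C)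
             (f : Fin a → A) (g : Fin b → A) (f′ : Fin a → B) (g′ : Fin b → B) →
             (λ i → (f ++ g) i ∙ (f′ ++ g′) i) ≗ (λ i → f i ∙ f′ i) ++ (λ i → g i ∙ g′ i)
zipWith-++ {a = a} _∙_ f g f′ g′ i with splitAt a i
... | inj₁ _ = refl
... | inj₂ _ = refl

sum-++ : ∀ {a b} (f : Fin a → Z₂) (g : Fin b → Z₂) → sum (f ++ g) ≡ sum f xor sum g
sum-++ {zero}  f g = refl
sum-++ {suc a} f g = begin
  f zero xor sum ((f ++ g) ∘ suc)    ≡⟨ cong (f zero xor_) (sum-cong-≗ (++-tail f g)) ⟩
  f zero xor sum (tail f ++ g)       ≡⟨ cong (f zero xor_) (sum-++ (tail f) g) ⟩
  f zero xor (sum (tail f) xor sum g) ≡⟨ xor-assoc (f zero) _ _ ⟨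
  sum f xor sum g                    ∎

lincomb : ∀ {m n} → (Fin m → Z₂) → (Fin m → Vec₂ n) → Vec₂ n
lincomb c w t = sum (λ k → c k ∧ w k t)

infix 4 _∈Span_

_∈Span_ : ∀ {m n} → Vec₂ n → (Fin m → Vec₂ n) → Set
u ∈Span w = ∃ λ c → u ≗ lincomb c w

LinDep : ∀ {m n} → (Fin m → Vec₂ n) → Set
LinDep v = ∃ λ c → (∃ λ i → c i ≡ true) × (∀ t → lincomb c v t ≡ false)

LinIndep⇒¬LinDep : ∀ {m n} {v : Fin m → Vec₂ n} → LinIndep v → ¬ LinDep v
LinIndep⇒¬LinDep ind (c , (i , cᵢ≡1) , rel)
  with () ← trans (sym cᵢ≡1) (ind c (λ t → trans (Σ₂≡sum (λ i → c i ∧ _)) (rel t)) i)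

¬LinIndep⇒¬¬LinDep : ∀ {m n} {v : Fin m → Vec₂ n} → ¬ LinIndep v → ¬ ¬ LinDep v
¬LinIndep⇒¬¬LinDep ¬ind ¬dep = ¬ind λ c rel i →
  ¬-not (λ cᵢ≡1 → ¬dep (c , (i , cᵢ≡1) , λ t → trans (sym (Σ₂≡sum (λ i → c i ∧ _))) (rel t)))

lincomb-zeroˡ : ∀ {m n} {c : Fin m → Z₂} (w : Fin m → Vec₂ n) → (∀ k → c k ≡ false) → ∀ t → lincomb c w t ≡ false
lincomb-zeroˡ w c≡0 t = sum-zero (λ k → cong (_∧ w k t) (c≡0 k))

lincomb-insertAt : ∀ {m n} (c : Fin m → Z₂) (p : Fin (suc m)) (x : Z₂) (v : Fin (suc m) → Vec₂ n) t →
                   lincomb (insertAt c p x) v t ≡ (x ∧ v p t) xor lincomb c (removeAt v p) t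
lincomb-insertAt c p x v t = begin
  lincomb (insertAt c p x) v t
    ≡⟨ sum-remove {i = p} (λ k → insertAt c p x k ∧ v k t) ⟩
  (insertAt c p x p ∧ v p t) xor sum (λ j → insertAt c p x (punchIn p j) ∧ v (punchIn p j) t)
    ≡⟨ cong₂ (λ a s → (a ∧ v p t) xor s) (insertAt-lookup c p x)
         (sum-cong-≗ (λ j → cong (_∧ v (punchIn p j) t) (insertAt-punchIn c p x j))) ⟩
  (x ∧ v p t) xor lincomb c (removeAt v p) t
    ∎

lincomb-shear : ∀ {s n} (b : Fin s → Z₂) (w : Fin s → Vec₂ n) (d : Fin s → Z₂) (x : Vec₂ n) t →
                lincomb b (λ j t → w j t xor (d j ∧ x t)) t ≡ lincomb b w t xor (sum (λ j → b j ∧ d j) ∧ x t)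
lincomb-shear b w d x t = begin
  sum (λ j → b j ∧ (w j t xor (d j ∧ x t)))
    ≡⟨ sum-cong-≗ (λ j → trans (∧-distribˡ-xor (b j) _ _) (cong ((b j ∧ w j t) xor_) (sym (∧-assoc (b j) (d j) (x t))))) ⟩
  sum (λ j → (b j ∧ w j t) xor ((b j ∧ d j) ∧ x t))
    ≡⟨ ∑-distrib-+ (λ j → b j ∧ w j t) (λ j → (b j ∧ d j) ∧ x t) ⟩
  lincomb b w t xor sum (λ j → (b j ∧ d j) ∧ x t)
    ≡⟨ cong (lincomb b w t xor_) (*-distribʳ-sum (x t) (λ j → b j ∧ d j)) ⟨
  lincomb b w t xor (sum (λ j → b j ∧ d j) ∧ x t)
    ∎

LinDep-of-tails : ∀ {s m} (v : Fin s → Vec₂ (suc m)) → (∀ i → v i zero ≡ false) → LinDep (tail ∘ v) → LinDep v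
LinDep-of-tails v head≡0 (c , nontrivial , rel) = c , nontrivial , λ
  { zero    → sum-zero (λ i → trans (cong (c i ∧_) (head≡0 i)) (∧-zeroʳ (c i)))
  ; (suc t) → rel t }

-- Gaussian elimination with pivot v p: add v p to every other vector whose first coordinate is 1.
eliminate : ∀ {s m} → (Fin (suc s) → Vec₂ (suc m)) → Fin (suc s) → Fin s → Vec₂ (suc m)
eliminate v p j t = v (punchIn p j) t xor (v (punchIn p j) zero ∧ v p t)

eliminate-head : ∀ {s m} (v : Fin (suc s) → Vec₂ (suc m)) p → v p zero ≡ true → ∀ j → eliminate v p j zero ≡ false
eliminate-head v p pivot j = begin
  x xor (x ∧ v p zero) ≡⟨ cong (λ b → x xor (x ∧ b)) pivot ⟩
  x xor (x ∧ true)     ≡⟨ cong (x xor_) (∧-identityʳ x) ⟩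
  x xor x              ≡⟨ xor-same x ⟩
  false                ∎
  where x = v (punchIn p j) zero

LinDep-eliminate : ∀ {s m} (v : Fin (suc s) → Vec₂ (suc m)) p → LinDep (eliminate v p) → LinDep v
LinDep-eliminate v p (b , (j , bⱼ≡1) , rel) =
  insertAt b p λ₀ , (punchIn p j , trans (insertAt-punchIn b p λ₀ j) bⱼ≡1) , λ t → begin
    lincomb (insertAt b p λ₀) v t                ≡⟨ lincomb-insertAt b p λ₀ v t ⟩
    (λ₀ ∧ v p t) xor lincomb b (removeAt v p) t   ≡⟨ xor-comm (λ₀ ∧ v p t) _ ⟩
    lincomb b (removeAt v p) t xor (λ₀ ∧ v p t)   ≡⟨ lincomb-shear b (removeAt v p) (λ j → v (punchIn p j) zero) (v p) t ⟨
    lincomb b (eliminate v p) t                  ≡⟨ rel t ⟩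
    false                                        ∎
  where λ₀ = sum (λ j → b j ∧ v (punchIn p j) zero)

dim<card⇒LinDep : ∀ m {s} → m < s → (v : Fin s → Vec₂ m) → LinDep v
dim<card⇒LinDep zero    (s≤s _)   v = (λ _ → true) , (zero , refl) , λ ()
dim<card⇒LinDep (suc m) (s≤s m<s) v with any? (λ i → v i zero Bool.≟ true)
... | yes (p , pivot) = LinDep-eliminate v p
        (LinDep-of-tails (eliminate v p) (eliminate-head v p pivot) (dim<card⇒LinDep m m<s (tail ∘ eliminate v p)))
... | no  noPivot     = LinDep-of-tails v (λ i → ¬-not (λ vᵢ₀≡1 → noPivot (i , vᵢ₀≡1)))
        (dim<card⇒LinDep m (m≤n⇒m≤1+n m<s) (tail ∘ v))

lincomb-lincomb : ∀ {s m n} (a : Fin s → Z₂) (cs : Fin s → Fin m → Z₂) (w : Fin m → Vec₂ n) t →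
                  lincomb a (λ i → lincomb (cs i) w) t ≡ lincomb (lincomb a cs) w t
lincomb-lincomb a cs w t = begin
  sum (λ i → a i ∧ sum (λ k → cs i k ∧ w k t))
    ≡⟨ sum-cong-≗ (λ i → *-distribˡ-sum (a i) (λ k → cs i k ∧ w k t)) ⟩
  sum (λ i → sum (λ k → a i ∧ (cs i k ∧ w k t)))
    ≡⟨ ∑-comm (λ i k → a i ∧ (cs i k ∧ w k t)) ⟩
  sum (λ k → sum (λ i → a i ∧ (cs i k ∧ w k t)))
    ≡⟨ sum-cong-≗ (λ k → trans (sum-cong-≗ (λ i → sym (∧-assoc (a i) (cs i k) (w k t))))
                                (sym (*-distribʳ-sum (w k t) (λ i → a i ∧ cs i k)))) ⟩
  sum (λ k → sum (λ i → a i ∧ cs i k) ∧ w k t)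
    ∎

¬¬-∀Fin : ∀ {s} {P : Fin s → Set} → (∀ i → ¬ ¬ P i) → ¬ ¬ (∀ i → P i)
¬¬-∀Fin {zero}  _   ¬all = ¬all (λ ())
¬¬-∀Fin {suc s} ¬¬P ¬all =
  ¬¬P zero λ P₀ → ¬¬-∀Fin (¬¬P ∘ suc) λ Pₛ → ¬all λ { zero → P₀ ; (suc i) → Pₛ i }

-- IsRank yields spanning only under double negation; deciding s ≤ m lets the argument run there.
LinIndep-⊆Span⇒≤ : ∀ {s m n} {u : Fin s → Vec₂ n} (w : Fin m → Vec₂ n) →
                   LinIndep u → (∀ i → ¬ ¬ (u i ∈Span w)) → s ≤ m
LinIndep-⊆Span⇒≤ {s} {m} {u = u} w ind spanned with s ≤? m
... | yes s≤m = s≤m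
... | no  s≰m = ⊥-elim (¬¬-∀Fin spanned overdetermined)
  where
  overdetermined : (∀ i → u i ∈Span w) → ⊥
  overdetermined span with dim<card⇒LinDep m (≰⇒> s≰m) (proj₁ ∘ span)
  ... | a , nontrivial , rel = LinIndep⇒¬LinDep ind (a , nontrivial , λ t → begin
    lincomb a u t                                  ≡⟨ sum-cong-≗ (λ i → cong (a i ∧_) (proj₂ (span i) t)) ⟩
    lincomb a (λ i → lincomb (proj₁ (span i)) w) t ≡⟨ lincomb-lincomb a (proj₁ ∘ span) w t ⟩
    lincomb (lincomb a (proj₁ ∘ span)) w t         ≡⟨ lincomb-zeroˡ w rel t ⟩
    false                                          ∎)

LinDep-∷⇒ : ∀ {m n} {u : Vec₂ n} {w : Fin m → Vec₂ n} → LinDep (u Vector.∷ w) → u ∈Span w ⊎ LinDep w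
LinDep-∷⇒ {u = u} (c , (i , cᵢ≡1) , rel) with c zero in c₀ | rel
... | true  | rel′ = inj₁ (tail c , λ t → xor≡false⇒≡ (u t) _ (rel′ t))
... | false | rel′ = inj₂ (tail c , nonzero-tail i cᵢ≡1 , rel′)
  where
  nonzero-tail : ∀ i → c i ≡ true → ∃ λ k → c (suc k) ≡ true
  nonzero-tail zero    c₀≡1 with () ← trans (sym c₀) c₀≡1
  nonzero-tail (suc k) cₖ≡1 = k , cₖ≡1

LinIndep-maximal⇒¬¬∈Span : ∀ {m n r} (v : Fin n → Vec₂ m) (f : Fin r → Fin n) j →
                           LinIndep (v ∘ f) → ¬ LinIndep (v ∘ (j Vector.∷ f)) → ¬ ¬ (v j ∈Span (v ∘ f))
LinIndep-maximal⇒¬¬∈Span v f j ind ¬ind ∉Span =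
  ¬LinIndep⇒¬¬LinDep {v = v j Vector.∷ (v ∘ f)} ¬ind λ dep →
    [ ∉Span , LinIndep⇒¬LinDep ind ]′ (LinDep-∷⇒ {u = v j} {w = v ∘ f} dep)

∈Span-resp-≗ : ∀ {m n} {u u′ : Vec₂ n} {w : Fin m → Vec₂ n} → u ≗ u′ → u′ ∈Span w → u ∈Span w
∈Span-resp-≗ u≗u′ (c , u′≗) = c , λ t → trans (u≗u′ t) (u′≗ t)

zero∈Span : ∀ {m n} {u : Vec₂ n} (w : Fin m → Vec₂ n) → (∀ t → u t ≡ false) → u ∈Span w
zero∈Span w u≡0 = (λ _ → false) , λ t → trans (u≡0 t) (sym (lincomb-zeroˡ w (λ _ → refl) t))

∈Span-member : ∀ {m n} (w : Fin m → Vec₂ n) k → w k ∈Span w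
∈Span-member {suc m} w k = col identity k , λ t → sym (begin
  lincomb (col identity k) w t
    ≡⟨ sum-remove {i = k} (λ k′ → identity k′ k ∧ w k′ t) ⟩
  (identity k k ∧ w k t) xor sum (λ j → identity (punchIn k j) k ∧ w (punchIn k j) t)
    ≡⟨ cong₂ (λ b s → (b ∧ w k t) xor s) (dec-true (k ≟ k) refl)
         (sum-zero (λ j → cong (_∧ w (punchIn k j) t) (dec-false (punchIn k j ≟ k) (punchInᵢ≢i k j)))) ⟩
  w k t xor false
    ≡⟨ xor-identityʳ (w k t) ⟩
  w k t
    ∎)

∈Span-++ : ∀ {a b n} {u u′ : Vec₂ n} {w : Fin a → Vec₂ n} {w′ : Fin b → Vec₂ n} →
           u ∈Span w → u′ ∈Span w′ → (λ t → u t xor u′ t) ∈Span (w ++ w′)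
∈Span-++ {u = u} {u′} {w} {w′} (c , u≗) (c′ , u′≗) = c ++ c′ , λ t → begin
  u t xor u′ t
    ≡⟨ cong₂ _xor_ (u≗ t) (u′≗ t) ⟩
  lincomb c w t xor lincomb c′ w′ t
    ≡⟨ sum-++ (λ k → c k ∧ w k t) (λ k → c′ k ∧ w′ k t) ⟨
  sum ((λ k → c k ∧ w k t) ++ (λ k → c′ k ∧ w′ k t))
    ≡⟨ sum-cong-≗ (zipWith-++ (λ a x → a ∧ x t) c c′ w w′) ⟨
  lincomb (c ++ c′) (w ++ w′) t
    ∎

diagonal-col : ∀ {n} {Y : Mat n} → IsDiagonal Y → ∀ j t → col Y j t ≡ Y j j ∧ identity t j
diagonal-col diag j t with t ≟ j
... | yes refl = sym (∧-identityʳ _)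
... | no  t≢j  = trans (diag t j t≢j) (sym (∧-zeroʳ _))

diagonal-col-∈Span : ∀ {n} {Y : Mat n} {P : Pred (Fin n) 0ℓ} (P? : Decidable P) → IsDiagonal Y →
                     (∀ t → Y t t ≡ true → P t) → ∀ j → col Y j ∈Span (col identity ∘ lookup (filter P? (allFin n)))
diagonal-col-∈Span {Y = Y} P? diag supported j with Y j j in Yⱼⱼ
... | false = zero∈Span _ (λ t → trans (diagonal-col diag j t) (cong (_∧ identity t j) Yⱼⱼ))
... | true  = ∈Span-resp-≗
  (λ t → trans (diagonal-col diag j t) (trans (cong (_∧ identity t j) Yⱼⱼ) (cong (identity t) (lookup-index j∈))))
  (∈Span-member _ (index j∈))
  where j∈ = ∈-filter⁺ P? (∈-allFin j) (supported j Yⱼⱼ)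

length-filter-+-length-filter-∁ : ∀ {A : Set} {P : Pred A 0ℓ} (P? : Decidable P) xs →
                                  length (filter P? xs) + length (filter (∁? P?) xs) ≡ length xs
length-filter-+-length-filter-∁ P? []       = refl
length-filter-+-length-filter-∁ P? (x ∷ xs) with P? x
... | yes _ = cong suc (length-filter-+-length-filter-∁ P? xs)
... | no  _ = trans (+-suc _ _) (cong suc (length-filter-+-length-filter-∁ P? xs))

rank-+-diagonal-≤ : ∀ {n r s} {A Y : Mat n} {P : Pred (Fin n) 0ℓ} (P? : Decidable P) →
                    IsRank A r → IsDiagonal Y → (∀ t → Y t t ≡ true → P t) →
                    (h : Fin s → Fin n) → LinIndep (col (A +ᴹ Y) ∘ h) → s ≤ r + length (filter P? (allFin n))
rank-+-diagonal-≤ {r = r} {A = A} P? ((f , indA) , maximal) diag supported h ind =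
  LinIndep-⊆Span⇒≤ (col A ∘ f ++ col identity ∘ lookup (filter P? (allFin _))) ind λ i ∉Span →
    LinIndep-maximal⇒¬¬∈Span (col A) f (h i) indA (maximal (suc r) ≤-refl (h i Vector.∷ f))
      (λ inA → ∉Span (∈Span-++ inA (diagonal-col-∈Span P? diag supported (h i))))

LinIndep-resp : ∀ {m n} {v v′ : Fin m → Vec₂ n} → (∀ i t → v i t ≡ v′ i t) → LinIndep v → LinIndep v′
LinIndep-resp v≗v′ ind c rel = ind c λ t → trans (Σ₂-cong (λ i → cong (c i ∧_) (v≗v′ i t))) (rel t)

NonDegenerate⇒LinIndep-col : ∀ {n} {M : Mat n} → NonDegenerate M → LinIndep (col M)
NonDegenerate⇒LinIndep-col {M = M} nd c rel = nd c λ t → trans (Σ₂-cong (λ j → ∧-comm (M t j) (c j))) (rel t)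

IsDiagonal-+identity : ∀ {n} {D : Mat n} → IsDiagonal D → IsDiagonal (D +ᴹ identity)
IsDiagonal-+identity diag i j i≢j = cong₂ _xor_ (diag i j i≢j) (dec-false (i ≟ j) i≢j)

rearrange : ∀ r a b → (r + b) + (r + a) ≡ 2 * r + (a + b)
rearrange = solve-∀

lemma7 : (n : ℕ) (M D : Mat n) → NonDegenerate M → IsDiagonal D →
    (r s : ℕ) → IsRank (M +ᴹ D) r → IsRank (M +ᴹ identity) s → s ≤ 2 * r
lemma7 n M D nd diag r s rank[M+D] ((g , indB) , _) =
  +-cancelʳ-≤ n s (2 * r) (subst (s + n ≤_) counted (+-mono-≤ s≤r+c₂ n≤r+c₁))
  where
  P? : Decidable (λ t → D t t ≡ true)
  P? t = D t t Bool.≟ true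
  c₁ c₂ : ℕ
  c₁ = length (filter P? (allFin n))
  c₂ = length (filter (∁? P?) (allFin n))

  n≤r+c₁ : n ≤ r + c₁
  n≤r+c₁ = rank-+-diagonal-≤ {A = M +ᴹ D} P? rank[M+D] diag (λ _ Dₜₜ≡1 → Dₜₜ≡1) (λ j → j)
    (LinIndep-resp (λ j t → xor-cancelʳ (M t j) (D t j)) (NonDegenerate⇒LinIndep-col nd))

  s≤r+c₂ : s ≤ r + c₂
  s≤r+c₂ = rank-+-diagonal-≤ {A = M +ᴹ D} (∁? P?) rank[M+D] (IsDiagonal-+identity diag)
    (λ t [D+I]ₜₜ≡1 Dₜₜ≡1 → Bool.not-¬ (cong₂ _xor_ Dₜₜ≡1 (dec-true (t ≟ t) refl)) [D+I]ₜₜ≡1) g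
    (LinIndep-resp (λ i t → xor-through (M t (g i)) (D t (g i)) (identity t (g i))) indB)

  counted : (r + c₂) + (r + c₁) ≡ 2 * r + n
  counted = trans (rearrange r c₁ c₂)
    (cong (2 * r +_) (trans (length-filter-+-length-filter-∁ P? (allFin n)) (length-tabulate (λ t → t))))
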